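{- The graph $R_{20}$ is Class 0, i.e. $\pi(R_{20})=20$.
   Context: $R_{20}$ is the graph on vertices $v_1,\dots,v_{20}$ whose adjacency lists (neighbors given by indices) are: $v_1$: 6,8,11,12,14,15,16,17; $v_2$: 4,5,6,7,8,10,15,16,17,18,19,20; $v_3$: 4,6,8,12,14,20; $v_4$: 2,3,5,6,8,9,12,15,18,19; $v_5$: 2,4,7,12,14,15,16,18,20; $v_6$: 1,2,3,4,7,8,14,15,19; $v_7$: 2,5,6,8,11,12,13,14,15,17,18; $v_8$: 1,2,3,4,6,7,10,11,14,15,17; $v_9$: 4,10,11,13,14,17,19,20; $v_{10}$: 2,8,9,16,18,19,20; $v_{11}$: 1,7,8,9,13,14,16,18,20; $v_{12}$: 1,3,4,5,7,13,16; $v_{13}$: 7,9,11,12,19,20; $v_{14}$: 1,3,5,6,7,8,9,11,18; $v_{15}$: 1,2,4,5,6,7,8,19; $v_{16}$: 1,2,5,10,11,12,18,20; $v_{17}$: 1,2,7,8,9,19; $v_{18}$: 2,4,5,7,10,11,14,16,20; $v_{19}$: 2,4,6,9,10,13,15,17,20; $v_{20}$: 2,3,5,9,10,11,13,16,18,19. A configuration on a connected graph $G$ is a function $C:V(G)\to\mathbb{N}$; a pebbling step from $u$ to a neighbor $v$ removes two pebbles from $u$ and adds one to $v$; $C$ is $r$-solvable if some sequence of pebbling steps places a pebble on $r$. $\pi(G,r)$ is the minimum $t$ such that every configuration with $t$ pebbles in total is $r$-solvable, $\pi(G)=\max_r\pi(G,r)$, and $G$ is Class 0 if $\pi(G)=|V(G)|$.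 -}

module Defs where

open import Data.Nat using (ℕ; zero; suc; _+_; _∸_; _≤_; _<_)
open import Data.Fin using (Fin; toℕ; _≟_)
open import Data.List using (List; []; _∷_; map; allFin)
open import Data.Nat.ListAction using (sum)
open import Data.List.Membership.Propositional using (_∈_)
open import Data.Vec using (Vec; lookup)
open import Data.Product using (Σ; _×_; ∃; ∃-syntax)
open import Relation.Nullary using (¬_; does)
open import Data.Bool using (if_then_else_)
open import Relation.Binary.PropositionalEquality using (_≡_)
open import Relation.Binary.Construct.Closure.ReflexiveTransitive using (Star)

Graph : ℕ → Set₁
Graph n = Fin n → Fin n → Set

Config : ℕ → Set
Config n = Fin n → ℕ

size : ∀ {n} → Config n → ℕ
size {n} C = sum (map C (allFin n))

move : ∀ {n} → Config n → Fin n → Fin n → Config n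
move C u v w =
  (if does (w ≟ u) then C w ∸ 2 else C w) + (if does (w ≟ v) then 1 else 0)

data Step {n} (G : Graph n) : Config n → Config n → Set where
  step : ∀ {C u v} → G u v → 2 ≤ C u → Step G C (move C u v)

Reach : ∀ {n} → Graph n → Config n → Config n → Set
Reach G = Star (Step G)

Solvable : ∀ {n} → Graph n → Config n → Fin n → Set
Solvable G C r = ∃[ D ] (Reach G C D × 1 ≤ D r)

AllSolvable : ∀ {n} → Graph n → Fin n → ℕ → Set
AllSolvable {n} G r t = (C : Config n) → size C ≡ t → Solvable G C r

RootedPebblingNumberIs : ∀ {n} → Graph n → Fin n → ℕ → Set
RootedPebblingNumberIs G r t =
  AllSolvable G r t × (∀ s → s < t → ¬ AllSolvable G r s)

PebblingNumberIs : ∀ {n} → Graph n → ℕ → Set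
PebblingNumberIs G t =
  (∀ r → ∃[ s ] (RootedPebblingNumberIs G r s × s ≤ t))
  × (∃[ r ] RootedPebblingNumberIs G r t)

Class0 : ∀ {n} → Graph n → Set
Class0 {n} G = PebblingNumberIs G n

-- Neighbour lists of R₂₀ (1-based indices, as in the paper); v_i is Fin index i-1.
R20-nbrs : Vec (List ℕ) 20
R20-nbrs =
  (6 ∷ 8 ∷ 11 ∷ 12 ∷ 14 ∷ 15 ∷ 16 ∷ 17 ∷ []) Data.Vec.∷
  (4 ∷ 5 ∷ 6 ∷ 7 ∷ 8 ∷ 10 ∷ 15 ∷ 16 ∷ 17 ∷ 18 ∷ 19 ∷ 20 ∷ []) Data.Vec.∷
  (4 ∷ 6 ∷ 8 ∷ 12 ∷ 14 ∷ 20 ∷ []) Data.Vec.∷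
  (2 ∷ 3 ∷ 5 ∷ 6 ∷ 8 ∷ 9 ∷ 12 ∷ 15 ∷ 18 ∷ 19 ∷ []) Data.Vec.∷
  (2 ∷ 4 ∷ 7 ∷ 12 ∷ 14 ∷ 15 ∷ 16 ∷ 18 ∷ 20 ∷ []) Data.Vec.∷
  (1 ∷ 2 ∷ 3 ∷ 4 ∷ 7 ∷ 8 ∷ 14 ∷ 15 ∷ 19 ∷ []) Data.Vec.∷
  (2 ∷ 5 ∷ 6 ∷ 8 ∷ 11 ∷ 12 ∷ 13 ∷ 14 ∷ 15 ∷ 17 ∷ 18 ∷ []) Data.Vec.∷
  (1 ∷ 2 ∷ 3 ∷ 4 ∷ 6 ∷ 7 ∷ 10 ∷ 11 ∷ 14 ∷ 15 ∷ 17 ∷ []) Data.Vec.∷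
  (4 ∷ 10 ∷ 11 ∷ 13 ∷ 14 ∷ 17 ∷ 19 ∷ 20 ∷ []) Data.Vec.∷
  (2 ∷ 8 ∷ 9 ∷ 16 ∷ 18 ∷ 19 ∷ 20 ∷ []) Data.Vec.∷
  (1 ∷ 7 ∷ 8 ∷ 9 ∷ 13 ∷ 14 ∷ 16 ∷ 18 ∷ 20 ∷ []) Data.Vec.∷
  (1 ∷ 3 ∷ 4 ∷ 5 ∷ 7 ∷ 13 ∷ 16 ∷ []) Data.Vec.∷
  (7 ∷ 9 ∷ 11 ∷ 12 ∷ 19 ∷ 20 ∷ []) Data.Vec.∷
  (1 ∷ 3 ∷ 5 ∷ 6 ∷ 7 ∷ 8 ∷ 9 ∷ 11 ∷ 18 ∷ []) Data.Vec.∷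
  (1 ∷ 2 ∷ 4 ∷ 5 ∷ 6 ∷ 7 ∷ 8 ∷ 19 ∷ []) Data.Vec.∷
  (1 ∷ 2 ∷ 5 ∷ 10 ∷ 11 ∷ 12 ∷ 18 ∷ 20 ∷ []) Data.Vec.∷
  (1 ∷ 2 ∷ 7 ∷ 8 ∷ 9 ∷ 19 ∷ []) Data.Vec.∷
  (2 ∷ 4 ∷ 5 ∷ 7 ∷ 10 ∷ 11 ∷ 14 ∷ 16 ∷ 20 ∷ []) Data.Vec.∷
  (2 ∷ 4 ∷ 6 ∷ 9 ∷ 10 ∷ 13 ∷ 15 ∷ 17 ∷ 20 ∷ []) Data.Vec.∷
  (2 ∷ 3 ∷ 5 ∷ 9 ∷ 10 ∷ 11 ∷ 13 ∷ 16 ∷ 18 ∷ 19 ∷ []) Data.Vec.∷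
  Data.Vec.[]

R20 : Graph 20
R20 u v = suc (toℕ v) ∈ lookup R20-nbrs u

-- Lower bound: one pebble on each of s < n non-root vertices admits no pebbling step.
--
-- Upper bound, by discharging.  Let C carry n pebbles, none on the root r, and call w far if it is
-- neither r nor a neighbour of r.  Each far vertex with at least two pebbles ships one unit to each
-- common neighbour of itself and r.  Unless C is r-solvable, every vertex v satisfies
-- C v + [v = r] + in v ≤ 1 + out v:  a neighbour of r holding a pebble receives no unit and an empty
-- one at most one (two pebbles arriving there could be moved on to r), while a far vertex holds at
-- most three pebbles (four reach r through a common neighbour), which its common neighbours absorb
-- as soon as it has two of them.  Summing over v, with  ∑ in = ∑ out,  gives n + 1 ≤ n.
-- In R₂₀ every far vertex has a common neighbour with the root, and at most one, u, has only one.
-- If u holds exactly three pebbles, it ships its third unit to a far neighbour y with two common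
-- neighbours; y then counts as a source as soon as it holds a pebble, since the step u → y completes
-- it to two, and as no neighbour of r is adjacent to both u and y, that step never takes pebbles
-- another source feeding the same vertex needs.
module Submission where

open import Defs
open import Data.Bool using (true; false)
open import Data.Nat using (ℕ; zero; suc; _+_; _∸_; _≤_; _<_; z≤n; s≤s; s≤s⁻¹; z<s; _<?_; _≤?_)
import Data.Nat as ℕ
open import Data.Nat.Properties
  using (≤-refl; ≤-reflexive; ≤-trans; ≤-antisym; ≤-pred; n≤0⇒n≡0; ≮⇒≥; ≰⇒>; <⇒≱; ≤∧≢⇒<; n<1+n;
         0≢1+n; +-comm; +-assoc; +-identityʳ; m≤m+n; m≤n+m; +-mono-≤; +-monoˡ-≤; +-monoʳ-≤;
         +-cancelʳ-≤; ∸-monoˡ-≤; +-*-semiring; module ≤-Reasoning)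
import Data.Nat.ListAction as List
open import Data.Fin using (Fin; zero; suc; toℕ; _≟_; punchOut)
open import Data.Fin.Properties using (suc-injective; punchIn-punchOut; any?; all?)
open import Data.List using (tabulate)
open import Data.List.Properties using (map-tabulate)
open import Data.List.Membership.DecPropositional ℕ._≟_ using (_∈?_)
open import Data.Vec using (lookup)
open import Data.Vec.Functional using (insertAt; removeAt)
open import Data.Vec.Functional.Properties using (insertAt-lookup; insertAt-punchIn)
open import Data.Product using (_×_; _,_; ∃; proj₂)
open import Data.Sum using (_⊎_; inj₁; inj₂; map₂)
open import Function using (_∘_; id)
open import Relation.Nullary using (Dec; _because_; yes; no; ¬_; ¬?; contradiction)
open import Relation.Nullary.Decidable
  using (dec-true; dec-false; _×-dec_; _⊎-dec_; _→-dec_; map′; from-yes; decidable-stable)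
open import Relation.Binary.Definitions using (Decidable; Symmetric)
open import Relation.Binary.PropositionalEquality
open import Relation.Binary.Construct.Closure.ReflexiveTransitive using (ε; _◅_)
open import Algebra.Properties.Semiring.Sum +-*-semiring
  using (sum; sum-syntax; ∑-distrib-+; ∑-comm; sum-remove; sum-cong-≗)

𝟙 : {P : Set} → Dec P → ℕ
𝟙 (true because _) = 1
𝟙 (false because _) = 0

𝟙-yes : {P : Set} (d : Dec P) → P → 𝟙 d ≡ 1
𝟙-yes (yes _) _ = refl
𝟙-yes (no ¬p) p = contradiction p ¬p

𝟙-no : {P : Set} (d : Dec P) → ¬ P → 𝟙 d ≡ 0
𝟙-no (yes p) ¬p = contradiction p ¬p
𝟙-no (no _) _ = refl

𝟙≤1 : {P : Set} (d : Dec P) → 𝟙 d ≤ 1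
𝟙≤1 (yes _) = s≤s z≤n
𝟙≤1 (no _) = z≤n

𝟙-mono : {P Q : Set} → (P → Q) → (d : Dec P) (e : Dec Q) → 𝟙 d ≤ 𝟙 e
𝟙-mono P⇒Q (yes p) e = ≤-reflexive (sym (𝟙-yes e (P⇒Q p)))
𝟙-mono P⇒Q (no _) e = z≤n

∑-mono-≤ : ∀ {n} {f g : Fin n → ℕ} → (∀ i → f i ≤ g i) → sum f ≤ sum g
∑-mono-≤ {zero} _ = z≤n
∑-mono-≤ {suc n} f≤g = +-mono-≤ (f≤g zero) (∑-mono-≤ (f≤g ∘ suc))

∑-zero : ∀ {n} {f : Fin n → ℕ} → (∀ i → f i ≡ 0) → sum f ≡ 0
∑-zero {zero} _ = refl
∑-zero {suc n} f≡0 = cong₂ _+_ (f≡0 zero) (∑-zero (f≡0 ∘ suc))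

∑-one : ∀ n → ∑[ i < n ] 1 ≡ n
∑-one zero = refl
∑-one (suc n) = cong suc (∑-one n)

∑-transfer : ∀ {n} (f h : Fin n → ℕ) (o : Fin n → Fin n → ℕ) →
             (∀ v → f v + ∑[ w < n ] o w v ≤ h v + ∑[ x < n ] o v x) → sum f ≤ sum h
∑-transfer {n} f h o balanced = +-cancelʳ-≤ total (sum f) (sum h) (begin
  sum f + total                           ≡⟨ cong (sum f +_) (∑-comm o) ⟩
  sum f + ∑[ v < n ] ∑[ w < n ] o w v     ≡⟨ ∑-distrib-+ f (λ v → ∑[ w < n ] o w v) ⟨
  ∑[ v < n ] (f v + ∑[ w < n ] o w v)     ≤⟨ ∑-mono-≤ balanced ⟩
  ∑[ v < n ] (h v + ∑[ x < n ] o v x)     ≡⟨ ∑-distrib-+ h (λ v → ∑[ x < n ] o v x) ⟩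
  sum h + total                           ∎)
  where
  open ≤-Reasoning
  total = ∑[ v < n ] ∑[ x < n ] o v x

count : ∀ {n} {P : Fin n → Set} → (∀ i → Dec (P i)) → ℕ
count {n} P? = ∑[ i < n ] 𝟙 (P? i)

count-none : ∀ {n} {P : Fin n → Set} (P? : ∀ i → Dec (P i)) → (∀ i → ¬ P i) → count P? ≡ 0
count-none P? ¬P = ∑-zero λ i → 𝟙-no (P? i) (¬P i)

count-pos : ∀ {n} {P : Fin n → Set} (P? : ∀ i → Dec (P i)) {i} → P i → 1 ≤ count P?
count-pos P? {zero} p = ≤-trans (≤-reflexive (sym (𝟙-yes (P? zero) p))) (m≤m+n _ _)
count-pos P? {suc i} p = ≤-trans (count-pos (P? ∘ suc) p) (m≤n+m _ _)

count-≤1 : ∀ {n} {P : Fin n → Set} (P? : ∀ i → Dec (P i)) →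
           (∀ {i j} → P i → P j → i ≡ j) → count P? ≤ 1
count-≤1 {zero} P? unique = z≤n
count-≤1 {suc n} {P} P? unique = split (P? zero)
  where
  split : (d : Dec (P zero)) → 𝟙 d + count (P? ∘ suc) ≤ 1
  split (yes p) = s≤s (≤-reflexive (count-none (P? ∘ suc) λ i q → 0≢1+n (cong toℕ (unique p q))))
  split (no _) = count-≤1 (P? ∘ suc) (λ p q → suc-injective (unique p q))

count-unique : ∀ {n} {P : Fin n → Set} (P? : ∀ i → Dec (P i)) {a} → P a →
               (∀ {i j} → P i → P j → i ≡ j) → count P? ≡ 1
count-unique P? p unique = ≤-antisym (count-≤1 P? unique) (count-pos P? p)

count-mono : ∀ {n} {P Q : Fin n → Set} (P? : ∀ i → Dec (P i)) (Q? : ∀ i → Dec (Q i)) →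
             (∀ {i} → P i → Q i) → count P? ≤ count Q?
count-mono P? Q? P⇒Q = ∑-mono-≤ λ i → 𝟙-mono P⇒Q (P? i) (Q? i)

count-cong : ∀ {n} {P Q : Fin n → Set} (P? : ∀ i → Dec (P i)) (Q? : ∀ i → Dec (Q i)) →
             (∀ {i} → P i → Q i) → (∀ {i} → Q i → P i) → count P? ≡ count Q?
count-cong P? Q? P⇒Q Q⇒P = ≤-antisym (count-mono P? Q? P⇒Q) (count-mono Q? P? Q⇒P)

count-≡×ˡ : ∀ {n} {Q : Set} (a : Fin n) (Q? : Dec Q) → count (λ i → (i ≟ a) ×-dec Q?) ≡ 𝟙 Q?
count-≡×ˡ a (yes q) =
  count-unique (λ i → (i ≟ a) ×-dec yes q) (refl , q) λ (i≡a , _) (j≡a , _) → trans i≡a (sym j≡a)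
count-≡×ˡ a (no ¬q) = count-none (λ i → (i ≟ a) ×-dec no ¬q) λ _ (_ , q) → ¬q q

count-≡×ʳ : ∀ {n} {Q : Set} (a : Fin n) (Q? : Dec Q) → count (λ i → Q? ×-dec (i ≟ a)) ≡ 𝟙 Q?
count-≡×ʳ a (yes q) =
  count-unique (λ i → yes q ×-dec (i ≟ a)) (q , refl) λ (_ , i≡a) (_ , j≡a) → trans i≡a (sym j≡a)
count-≡×ʳ a (no ¬q) = count-none (λ i → no ¬q ×-dec (i ≟ a)) λ _ (q , _) → ¬q q

count-toℕ< : ∀ {m} s → s ≤ m → count (λ (i : Fin m) → toℕ i <? s) ≡ s
count-toℕ< {zero} zero _ = refl
count-toℕ< {suc m} zero _ = count-none (λ (i : Fin (suc m)) → toℕ i <? 0) λ i ()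
count-toℕ< {suc m} (suc s) (s≤s s≤m) =
  cong₂ _+_ (𝟙-yes (0 <? suc s) z<s) (trans (count-cong shifted unshifted s≤s⁻¹ s≤s) (count-toℕ< s s≤m))
  where
  shifted unshifted : (i : Fin m) → Dec _
  shifted i = suc (toℕ i) <? suc s
  unshifted i = toℕ i <? s

∀-⊎ : ∀ {m} {A : Set} {P : Fin m → Set} → (∀ i → A ⊎ P i) → A ⊎ (∀ i → P i)
∀-⊎ {zero} _ = inj₂ λ ()
∀-⊎ {suc m} a⊎p with a⊎p zero | ∀-⊎ (a⊎p ∘ suc)
... | inj₁ a | _ = inj₁ a
... | inj₂ _ | inj₁ a = inj₁ a
... | inj₂ p | inj₂ ps = inj₂ λ { zero → p ; (suc i) → ps i }

size-∑ : ∀ {n} (C : Config n) → size C ≡ sum C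
size-∑ {n} C = trans (cong List.sum (map-tabulate id C)) (sum-tabulate C)
  where
  sum-tabulate : ∀ {m} (f : Fin m → ℕ) → List.sum (tabulate f) ≡ sum f
  sum-tabulate {zero} f = refl
  sum-tabulate {suc m} f = cong (f zero +_) (sum-tabulate (f ∘ suc))

module _ {n} (C : Config n) {u v : Fin n} (u≢v : u ≢ v) where

  move-source : move C u v u ≡ C u ∸ 2
  move-source rewrite dec-true (u ≟ u) refl | dec-false (u ≟ v) u≢v = +-identityʳ _

  move-target : move C u v v ≡ suc (C v)
  move-target rewrite dec-false (v ≟ u) (u≢v ∘ sym) | dec-true (v ≟ v) refl = +-comm _ 1

  move-other : ∀ {w} → w ≢ u → w ≢ v → move C u v w ≡ C w
  move-other {w} w≢u w≢v rewrite dec-false (w ≟ u) w≢u | dec-false (w ≟ v) w≢v = +-identityʳ _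

module _ {n} (G : Graph n) where

  solvable-root : ∀ {C r} → 1 ≤ C r → Solvable G C r
  solvable-root {C} 1≤Cr = C , ε , 1≤Cr

  solvable-step : ∀ {C u v r} → G u v → 2 ≤ C u → Solvable G (move C u v) r → Solvable G C r
  solvable-step uv 2≤Cu (D , reach , 1≤Dr) = D , step uv 2≤Cu ◅ reach , 1≤Dr

  sparse-stuck : ∀ {C D} → (∀ v → C v ≤ 1) → Reach G C D → D ≡ C
  sparse-stuck sparse ε = refl
  sparse-stuck sparse (step {u = u} _ 2≤Cu ◅ _) = contradiction (≤-trans 2≤Cu (sparse u)) λ { (s≤s ()) }

  sparse-unsolvable : ∀ {C r} → (∀ v → C v ≤ 1) → C r ≡ 0 → ¬ Solvable G C r
  sparse-unsolvable sparse Cr≡0 (D , reach , 1≤Dr) with refl ← sparse-stuck sparse reach =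
    contradiction (subst (1 ≤_) Cr≡0 1≤Dr) λ ()

module _ {m} (G : Graph (suc m)) where

  rooted-lower-bound : ∀ r s → s < suc m → ¬ AllSolvable G r s
  rooted-lower-bound r s (s≤s s≤m) allSolvable =
    sparse-unsolvable G sparse (insertAt-lookup ones r 0) (allSolvable spread spread-size)
    where
    ones : Fin m → ℕ
    ones i = 𝟙 (toℕ i <? s)

    spread : Config (suc m)
    spread = insertAt ones r 0

    sparse : ∀ v → spread v ≤ 1
    sparse v with r ≟ v
    ... | yes refl = subst (_≤ 1) (sym (insertAt-lookup ones r 0)) z≤n
    ... | no r≢v = subst (_≤ 1) spread-punchIn (𝟙≤1 _)
      where
      spread-punchIn : ones (punchOut r≢v) ≡ spread v
      spread-punchIn = trans (sym (insertAt-punchIn ones r 0 _)) (cong spread (punchIn-punchOut r≢v))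

    spread-size : size spread ≡ s
    spread-size = begin
      size spread                         ≡⟨ size-∑ spread ⟩
      sum spread                          ≡⟨ sum-remove {i = r} spread ⟩
      spread r + sum (removeAt spread r)  ≡⟨ cong₂ _+_ (insertAt-lookup ones r 0)
                                                       (sum-cong-≗ (insertAt-punchIn ones r 0)) ⟩
      sum ones                            ≡⟨ count-toℕ< s s≤m ⟩
      s                                   ∎
      where open ≡-Reasoning

  class0 : (∀ r → AllSolvable G r (suc m)) → Class0 G
  class0 upper = (λ r → suc m , rooted r , ≤-refl) , zero , rooted zero
    where
    rooted : ∀ r → RootedPebblingNumberIs G r (suc m)
    rooted r = upper r , rooted-lower-bound r

module Discharging {n} (G : Graph n) (G? : Decidable G) (G-sym : Symmetric G)
                   (G-irrefl : ∀ {v} → ¬ G v v) (r : Fin n) where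

  Far : Fin n → Set
  Far w = ¬ G r w × w ≢ r

  far? : ∀ w → Dec (Far w)
  far? w = ¬? (G? r w) ×-dec ¬? (w ≟ r)

  CommonNeighbour : Fin n → Fin n → Set
  CommonNeighbour w x = G w x × G r x

  commonNeighbour? : ∀ w x → Dec (CommonNeighbour w x)
  commonNeighbour? w x = G? w x ×-dec G? r x

  common : Fin n → ℕ
  common w = count (commonNeighbour? w)

  supply : {S : Fin n → Set} → (∀ w → Dec (S w)) → Fin n → ℕ
  supply S? w = count (λ x → S? w ×-dec commonNeighbour? w x)

  common≤supply : ∀ {S : Fin n → Set} (S? : ∀ w → Dec (S w)) {w} → S w → common w ≤ supply S? w
  common≤supply S? {w} s = count-mono (commonNeighbour? w) (λ x → S? w ×-dec commonNeighbour? w x) (s ,_)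

  Poor : Fin n → Set
  Poor w = Far w × common w < 2

  poor? : ∀ w → Dec (Poor w)
  poor? w = far? w ×-dec (common w <? 2)

  record Helper (u y : Fin n) : Set where
    field
      far : Far y
      edge : G u y
      rich : 2 ≤ common y
      separated : ∀ {v} → G r v → G u v → ¬ G y v

  helper? : ∀ u y → Dec (Helper u y)
  helper? u y = map′
    (λ (f , e , c , s) → record { far = f ; edge = e ; rich = c ; separated = λ rv uv → s _ rv uv })
    (λ h → let open Helper h in far , edge , rich , λ _ → separated)
    (far? y ×-dec G? u y ×-dec 2 ≤? common y ×-dec all? λ v → G? r v →-dec G? u v →-dec ¬? (G? y v))

  adj⇒≢ : ∀ {u v} → G u v → u ≢ v
  adj⇒≢ uv refl = G-irrefl uv

  far-near-≢ : ∀ {w v} → Far w → G r v → w ≢ v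
  far-near-≢ (¬rw , _) rv refl = ¬rw rv

  solvable-from-neighbour : ∀ {C x} → G x r → 2 ≤ C x → Solvable G C r
  solvable-from-neighbour {C} xr 2≤Cx = solvable-step G xr 2≤Cx
    (solvable-root G (subst (1 ≤_) (sym (move-target C (adj⇒≢ xr))) (s≤s z≤n)))

  relay : ∀ {C w v} → G w v → G r v → 2 ≤ C w → 1 ≤ C v → Solvable G C r
  relay {C} wv rv 2≤Cw 1≤Cv = solvable-step G wv 2≤Cw
    (solvable-from-neighbour (G-sym rv) (subst (2 ≤_) (sym (move-target C (adj⇒≢ wv))) (s≤s 1≤Cv)))

  relay₂ : ∀ {C w w' v} → w ≢ w' → G w v → G w' v → G r v → 2 ≤ C w → 2 ≤ C w' → Solvable G C r
  relay₂ {C} w≢w' wv w'v rv 2≤Cw 2≤Cw' = solvable-step G wv 2≤Cw (relay w'v rv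
    (subst (2 ≤_) (sym (move-other C (adj⇒≢ wv) (w≢w' ∘ sym) (adj⇒≢ w'v))) 2≤Cw')
    (subst (1 ≤_) (sym (move-target C (adj⇒≢ wv))) (s≤s z≤n)))

  solvable-via-common : ∀ {C w x} → CommonNeighbour w x → 4 ≤ C w → Solvable G C r
  solvable-via-common {C} (wx , rx) 4≤Cw = solvable-step G wx (≤-trans (s≤s (s≤s z≤n)) 4≤Cw) (relay wx rx
    (subst (2 ≤_) (sym (move-source C (adj⇒≢ wx))) (∸-monoˡ-≤ 2 4≤Cw))
    (subst (1 ≤_) (sym (move-target C (adj⇒≢ wx))) (s≤s z≤n)))

  -- Every source ships one unit to each of its common neighbours with r, and every w ships
  -- surplus w x further units to the far vertex x.  The feed fields say that units shipped to a
  -- neighbour of r stand for pebbles that can actually be brought there.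
  record Scheme (C : Config n) : Set₁ where
    field
      Source : Fin n → Set
      source? : ∀ w → Dec (Source w)
      surplus : Fin n → Fin n → ℕ
      surplus-far : ∀ w {v} → ¬ Far v → surplus w v ≡ 0
      feed-one : ∀ {v w} → G r v → 1 ≤ C v → Source w → G w v → Solvable G C r
      feed-two : ∀ {v w w'} → G r v → w ≢ w' → Source w → G w v → Source w' → G w' v → Solvable G C r
      far-balanced : ∀ {v} → Far v → Solvable G C r ⊎
        C v + ∑[ w < n ] surplus w v ≤ 1 + supply source? v + ∑[ x < n ] surplus v x

  module _ {C : Config n} (σ : Scheme C) where
    open Scheme σ

    feeds? : ∀ w x → Dec (Source w × CommonNeighbour w x)
    feeds? w x = source? w ×-dec commonNeighbour? w x

    intake : Fin n → ℕ
    intake v = count (λ w → feeds? w v)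

    flow : Fin n → Fin n → ℕ
    flow w x = 𝟙 (feeds? w x) + surplus w x

    -- [v = r] on the left, rather than [v ≠ r] on the right, keeps the sum over v free of subtraction.
    Balanced : Fin n → Set
    Balanced v = C v + 𝟙 (v ≟ r) + ∑[ w < n ] flow w v ≤ 1 + ∑[ x < n ] flow v x

    inflow-split : ∀ v → ∑[ w < n ] flow w v ≡ intake v + ∑[ w < n ] surplus w v
    inflow-split v = ∑-distrib-+ (λ w → 𝟙 (feeds? w v)) (λ w → surplus w v)

    outflow-split : ∀ v → ∑[ x < n ] flow v x ≡ supply source? v + ∑[ x < n ] surplus v x
    outflow-split v = ∑-distrib-+ (λ x → 𝟙 (feeds? v x)) (surplus v)

    intake-nonneighbour : ∀ {v} → ¬ G r v → intake v ≡ 0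
    intake-nonneighbour {v} ¬rv = count-none (λ w → feeds? w v) λ _ (_ , _ , rv) → ¬rv rv

    inflow-near : ∀ {v} → G r v → ∑[ w < n ] flow w v ≡ intake v
    inflow-near {v} rv = begin
      ∑[ w < n ] flow w v                ≡⟨ inflow-split v ⟩
      intake v + ∑[ w < n ] surplus w v  ≡⟨ cong (intake v +_) (∑-zero λ w → surplus-far w near-not-far) ⟩
      intake v + 0                       ≡⟨ +-identityʳ (intake v) ⟩
      intake v                           ∎
      where
      open ≡-Reasoning
      near-not-far : ¬ Far v
      near-not-far (¬rv , _) = ¬rv rv

    balanced-root : Solvable G C r ⊎ Balanced r
    balanced-root with 1 ≤? C r
    ... | yes 1≤Cr = inj₁ (solvable-root G 1≤Cr)
    ... | no 1≰Cr = inj₂ (begin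
      C r + 𝟙 (r ≟ r) + ∑[ w < n ] flow w r  ≡⟨ cong₂ _+_ (cong₂ _+_ Cr≡0 (𝟙-yes (r ≟ r) refl)) inflow≡0 ⟩
      1                                      ≤⟨ m≤m+n 1 _ ⟩
      1 + ∑[ x < n ] flow r x                ∎)
      where
      open ≤-Reasoning
      Cr≡0 = n≤0⇒n≡0 (≮⇒≥ 1≰Cr)
      inflow≡0 : ∑[ w < n ] flow w r ≡ 0
      inflow≡0 = trans (inflow-split r)
        (cong₂ _+_ (intake-nonneighbour G-irrefl) (∑-zero λ w → surplus-far w λ (_ , r≢r) → r≢r refl))

    near-load : ∀ {v} → G r v → Solvable G C r ⊎ C v + intake v ≤ 1
    near-load {v} rv with 2 ≤? C v | 1 ≤? C v
    ... | yes 2≤Cv | _ = inj₁ (solvable-from-neighbour (G-sym rv) 2≤Cv)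
    ... | no 2≰Cv | yes 1≤Cv with any? (λ w → source? w ×-dec G? w v)
    ...   | yes (w , sw , wv) = inj₁ (feed-one rv 1≤Cv sw wv)
    ...   | no no-feeder = inj₂ (begin
      C v + intake v  ≡⟨ cong (C v +_) unfed ⟩
      C v + 0         ≡⟨ +-identityʳ (C v) ⟩
      C v             ≤⟨ ≤-pred (≰⇒> 2≰Cv) ⟩
      1               ∎)
      where
      open ≤-Reasoning
      unfed : intake v ≡ 0
      unfed = count-none (λ w → feeds? w v) λ w (sw , wv , _) → no-feeder (w , sw , wv)
    near-load {v} rv | no _ | no 1≰Cv
      with any? (λ w → any? λ w' → ¬? (w ≟ w') ×-dec (source? w ×-dec G? w v) ×-dec (source? w' ×-dec G? w' v))
    ...   | yes (w , w' , w≢w' , (sw , wv) , (sw' , w'v)) = inj₁ (feed-two rv w≢w' sw wv sw' w'v)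
    ...   | no no-pair = inj₂ (begin
      C v + intake v  ≡⟨ cong (_+ intake v) (n≤0⇒n≡0 (≮⇒≥ 1≰Cv)) ⟩
      intake v        ≤⟨ count-≤1 (λ w → feeds? w v) single-feeder ⟩
      1               ∎)
      where
      open ≤-Reasoning
      single-feeder : ∀ {w w'} → Source w × CommonNeighbour w v → Source w' × CommonNeighbour w' v → w ≡ w'
      single-feeder {w} {w'} (sw , wv , _) (sw' , w'v , _) =
        decidable-stable (w ≟ w') λ w≢w' → no-pair (w , w' , w≢w' , (sw , wv) , (sw' , w'v))

    balanced-near : ∀ {v} → v ≢ r → G r v → Solvable G C r ⊎ Balanced v
    balanced-near {v} v≢r rv = map₂ (λ load → begin
      C v + 𝟙 (v ≟ r) + ∑[ w < n ] flow w v  ≡⟨ cong₂ _+_ (cong (C v +_) (𝟙-no (v ≟ r) v≢r)) (inflow-near rv) ⟩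
      C v + 0 + intake v                     ≡⟨ cong (_+ intake v) (+-identityʳ (C v)) ⟩
      C v + intake v                         ≤⟨ load ⟩
      1                                      ≤⟨ m≤m+n 1 _ ⟩
      1 + ∑[ x < n ] flow v x                ∎) (near-load rv)
      where open ≤-Reasoning

    balanced-far : ∀ {v} → Far v → Solvable G C r ⊎ Balanced v
    balanced-far {v} far@(¬rv , v≢r) = map₂ (λ local → begin
      C v + 𝟙 (v ≟ r) + ∑[ w < n ] flow w v
        ≡⟨ cong₂ _+_ (cong (C v +_) (𝟙-no (v ≟ r) v≢r)) (inflow-split v) ⟩
      C v + 0 + (intake v + surplusIn)
        ≡⟨ cong₂ _+_ (+-identityʳ (C v)) (cong (_+ surplusIn) (intake-nonneighbour ¬rv)) ⟩
      C v + surplusIn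
        ≤⟨ local ⟩
      1 + supply source? v + surplusOut
        ≡⟨ +-assoc 1 (supply source? v) surplusOut ⟩
      1 + (supply source? v + surplusOut)
        ≡⟨ cong (1 +_) (outflow-split v) ⟨
      1 + ∑[ x < n ] flow v x
        ∎) (far-balanced far)
      where
      open ≤-Reasoning
      surplusIn = ∑[ w < n ] surplus w v
      surplusOut = ∑[ x < n ] surplus v x

    balanced : ∀ v → Solvable G C r ⊎ Balanced v
    balanced v = by-position (v ≟ r) (G? r v)
      where
      by-position : Dec (v ≡ r) → Dec (G r v) → Solvable G C r ⊎ Balanced v
      by-position (yes v≡r) _ = subst (λ z → Solvable G C r ⊎ Balanced z) (sym v≡r) balanced-root
      by-position (no v≢r) (yes rv) = balanced-near v≢r rv
      by-position (no v≢r) (no ¬rv) = balanced-far (¬rv , v≢r)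

    discharge : size C ≡ n → Solvable G C r
    discharge size≡n with ∀-⊎ balanced
    ... | inj₁ solved = solved
    ... | inj₂ all-balanced = contradiction (∑-transfer _ (λ _ → 1) flow all-balanced) (<⇒≱ (begin-strict
      ∑[ v < n ] 1                  ≡⟨ ∑-one n ⟩
      n                             <⟨ n<1+n n ⟩
      suc n                         ≡⟨ +-comm 1 n ⟩
      n + 1                         ≡⟨ cong₂ _+_ (trans (sym (size-∑ C)) size≡n) root-once ⟨
      sum C + count (_≟ r)          ≡⟨ ∑-distrib-+ C (λ v → 𝟙 (v ≟ r)) ⟨
      ∑[ v < n ] (C v + 𝟙 (v ≟ r))  ∎))
      where
      open ≤-Reasoning
      root-once : count (_≟ r) ≡ 1
      root-once = count-unique (_≟ r) refl λ i≡r j≡r → trans i≡r (sym j≡r)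

  without-surplus : ∀ {a b} → a ≤ 1 + b → a + ∑[ w < n ] 0 ≤ 1 + b + ∑[ x < n ] 0
  without-surplus {a} {b} a≤1+b
    rewrite ∑-zero {n} {λ _ → 0} (λ _ → refl) | +-identityʳ a | +-identityʳ (1 + b) = a≤1+b

  module _ (diameter-two : ∀ {w} → Far w → ∃ (CommonNeighbour w)) where

    common-pos : ∀ {w} → Far w → 1 ≤ common w
    common-pos far = count-pos (commonNeighbour? _) (proj₂ (diameter-two far))

    far-load : ∀ {C v} {S : Fin n → Set} (S? : ∀ w → Dec (S w)) → Far v → (2 ≤ C v → S v) →
               (2 ≤ C v → C v ≤ 3 → C v ≤ 1 + common v) → Solvable G C r ⊎ C v ≤ 1 + supply S? v
    far-load {C} {v} S? far source affordable with 4 ≤? C v | 2 ≤? C v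
    ... | yes 4≤Cv | _ = inj₁ (solvable-via-common (proj₂ (diameter-two far)) 4≤Cv)
    ... | no 4≰Cv | yes 2≤Cv = inj₂ (≤-trans (affordable 2≤Cv (≤-pred (≰⇒> 4≰Cv)))
                                              (+-monoʳ-≤ 1 (common≤supply S? (source 2≤Cv))))
    ... | no _ | no 2≰Cv = inj₂ (≤-trans (≤-pred (≰⇒> 2≰Cv)) (m≤m+n 1 _))

    plain-scheme : ∀ {C} → (∀ {w} → Far w → 2 ≤ C w → C w ≤ 3 → C w ≤ 1 + common w) → Scheme C
    plain-scheme {C} affordable = record
      { Source = λ w → Far w × 2 ≤ C w
      ; source? = source?
      ; surplus = λ _ _ → 0
      ; surplus-far = λ _ _ → refl
      ; feed-one = λ rv 1≤Cv (_ , 2≤Cw) wv → relay wv rv 2≤Cw 1≤Cv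
      ; feed-two = λ rv w≢w' (_ , 2≤Cw) wv (_ , 2≤Cw') w'v → relay₂ w≢w' wv w'v rv 2≤Cw 2≤Cw'
      ; far-balanced = λ far → map₂ without-surplus (far-load source? far (far ,_) (affordable far))
      }
      where
      source? : ∀ w → Dec (Far w × 2 ≤ C w)
      source? w = far? w ×-dec (2 ≤? C w)

    module Boosted {C : Config n} {u y : Fin n} (helper : Helper u y) (u-far : Far u) (Cu≡3 : C u ≡ 3)
                   (Cy≤2 : C y ≤ 2) (rich : ∀ {w} → Far w → w ≢ u → 2 ≤ common w) where
      open Helper helper renaming (far to y-far; edge to uy; rich to rich-y)

      u≢y : u ≢ y
      u≢y = adj⇒≢ uy

      Source : Fin n → Set
      Source w = Far w × (2 ≤ C w ⊎ (w ≡ y × 1 ≤ C y))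

      source? : ∀ w → Dec (Source w)
      source? w = far? w ×-dec ((2 ≤? C w) ⊎-dec ((w ≟ y) ×-dec (1 ≤? C y)))

      surplus : Fin n → Fin n → ℕ
      surplus w x = 𝟙 ((w ≟ u) ×-dec (x ≟ y))

      surplus-far : ∀ w {v} → ¬ Far v → surplus w v ≡ 0
      surplus-far w {v} ¬far = 𝟙-no ((w ≟ u) ×-dec (v ≟ y)) λ (_ , v≡y) → ¬far (subst Far (sym v≡y) y-far)

      2≤Cu : 2 ≤ C u
      2≤Cu = subst (2 ≤_) (sym Cu≡3) (s≤s (s≤s z≤n))

      boost : Solvable G (move C u y) r → Solvable G C r
      boost = solvable-step G uy 2≤Cu

      boosted-y : 1 ≤ C y → 2 ≤ move C u y y
      boosted-y 1≤Cy = subst (2 ≤_) (sym (move-target C u≢y)) (s≤s 1≤Cy)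

      unboosted : ∀ {w} → w ≢ u → w ≢ y → move C u y w ≡ C w
      unboosted = move-other C u≢y

      feed-one : ∀ {v w} → G r v → 1 ≤ C v → Source w → G w v → Solvable G C r
      feed-one rv 1≤Cv (_ , inj₁ 2≤Cw) wv = relay wv rv 2≤Cw 1≤Cv
      feed-one rv 1≤Cv (_ , inj₂ (refl , 1≤Cy)) yv = boost (relay yv rv (boosted-y 1≤Cy)
        (subst (1 ≤_) (sym (unboosted (far-near-≢ u-far rv ∘ sym) (far-near-≢ y-far rv ∘ sym))) 1≤Cv))

      feed-with-y : ∀ {v w} → G r v → w ≢ y → G w v → G y v → 1 ≤ C y → 2 ≤ C w → Solvable G C r
      feed-with-y {v} {w} rv w≢y wv yv 1≤Cy 2≤Cw = boost (relay₂ (w≢y ∘ sym) yv wv rv (boosted-y 1≤Cy)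
        (subst (2 ≤_) (sym (unboosted w≢u w≢y)) 2≤Cw))
        where
        w≢u : w ≢ u
        w≢u refl = separated rv wv yv

      feed-two : ∀ {v w w'} → G r v → w ≢ w' → Source w → G w v → Source w' → G w' v → Solvable G C r
      feed-two rv w≢w' (_ , inj₁ 2≤Cw) wv (_ , inj₁ 2≤Cw') w'v = relay₂ w≢w' wv w'v rv 2≤Cw 2≤Cw'
      feed-two rv w≢w' (_ , inj₂ (refl , 1≤Cy)) yv (_ , inj₁ 2≤Cw') w'v =
        feed-with-y rv (w≢w' ∘ sym) w'v yv 1≤Cy 2≤Cw'
      feed-two rv w≢w' (_ , inj₁ 2≤Cw) wv (_ , inj₂ (refl , 1≤Cy)) yv = feed-with-y rv w≢w' wv yv 1≤Cy 2≤Cw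
      feed-two rv w≢w' (_ , inj₂ (refl , _)) _ (_ , inj₂ (refl , _)) _ = contradiction refl w≢w'

      balance : ∀ {v} → Far v → (v≟u : Dec (v ≡ u)) (v≟y : Dec (v ≡ y)) →
                Solvable G C r ⊎ C v + 𝟙 v≟y ≤ 1 + supply source? v + 𝟙 v≟u
      balance far (yes refl) v≟y = inj₂ (≤-trans (≤-reflexive (cong₂ _+_ Cu≡3 (𝟙-no v≟y u≢y)))
        (+-monoˡ-≤ 1 (s≤s (≤-trans (common-pos u-far) (common≤supply source? (u-far , inj₁ 2≤Cu))))))
      balance far (no _) (yes refl) = y-balance (1 ≤? C y)
        where
        y-balance : Dec (1 ≤ C y) → Solvable G C r ⊎ C y + 1 ≤ 1 + supply source? y + 0
        y-balance (no 1≰Cy) = inj₂ (≤-trans (≤-reflexive (cong (_+ 1) (n≤0⇒n≡0 (≮⇒≥ 1≰Cy)))) (m≤m+n 1 _))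
        y-balance (yes 1≤Cy) = inj₂ (begin
          C y + 1                   ≡⟨ +-comm (C y) 1 ⟩
          1 + C y                   ≤⟨ +-monoʳ-≤ 1 (≤-trans Cy≤2 (≤-trans rich-y y-supply)) ⟩
          1 + supply source? y      ≡⟨ +-identityʳ (1 + supply source? y) ⟨
          1 + supply source? y + 0  ∎)
          where
          open ≤-Reasoning
          y-supply = common≤supply source? (y-far , inj₂ (refl , 1≤Cy))
      balance far (no v≢u) (no v≢y) = map₂ (+-monoˡ-≤ 0)
        (far-load source? far (λ 2≤Cv → far , inj₁ 2≤Cv) λ _ Cv≤3 → ≤-trans Cv≤3 (s≤s (rich far v≢u)))

      far-balanced : ∀ {v} → Far v → Solvable G C r ⊎
        C v + ∑[ w < n ] surplus w v ≤ 1 + supply source? v + ∑[ x < n ] surplus v x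
      far-balanced {v} far rewrite count-≡×ˡ u (v ≟ y) | count-≡×ʳ y (v ≟ u) = balance far (v ≟ u) (v ≟ y)

      scheme : Scheme C
      scheme = record
        { Source = Source
        ; source? = source?
        ; surplus = surplus
        ; surplus-far = surplus-far
        ; feed-one = feed-one
        ; feed-two = feed-two
        ; far-balanced = far-balanced
        }

    upper-bound : (∀ {u w} → Poor u → Poor w → u ≡ w) → (∀ {u} → Poor u → ∃ (Helper u)) →
                  AllSolvable G r n
    upper-bound poor-unique helper C size≡n with any? (λ u → poor? u ×-dec (C u ℕ.≟ 3))
    ... | no no-poor-3 = discharge (plain-scheme affordable) size≡n
      where
      affordable : ∀ {w} → Far w → 2 ≤ C w → C w ≤ 3 → C w ≤ 1 + common w
      affordable {w} far _ Cw≤3 with common w <? 2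
      ... | yes w-poor = ≤-trans (≤-pred (≤∧≢⇒< Cw≤3 λ Cw≡3 → no-poor-3 (w , (far , w-poor) , Cw≡3)))
                                 (s≤s (common-pos far))
      ... | no w-rich = ≤-trans Cw≤3 (s≤s (≮⇒≥ w-rich))
    ... | yes (u , (u-far , u-poor) , Cu≡3) with helper (u-far , u-poor)
    ...   | y , h with C y ≤? 2
    ...     | yes Cy≤2 = discharge (Boosted.scheme h u-far Cu≡3 Cy≤2 rich) size≡n
      where
      rich : ∀ {w} → Far w → w ≢ u → 2 ≤ common w
      rich far w≢u = ≮⇒≥ λ w-poor → w≢u (poor-unique (far , w-poor) (u-far , u-poor))
    ...     | no Cy≰2 = solvable-step G uy (subst (2 ≤_) (sym Cu≡3) (s≤s (s≤s z≤n)))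
      (solvable-via-common (proj₂ (diameter-two y-far)) 4≤C′y)
      where
      open Helper h renaming (far to y-far; edge to uy)
      4≤C′y : 4 ≤ move C u y y
      4≤C′y = subst (4 ≤_) (sym (move-target C (adj⇒≢ uy))) (s≤s (≰⇒> Cy≰2))

R20? : Decidable R20
R20? u v = suc (toℕ v) ∈? lookup R20-nbrs u

R20-symmetric : Symmetric R20
R20-symmetric {u} {v} = from-yes (all? λ u → all? λ v → R20? u v →-dec R20? v u) u v

R20-irreflexive : ∀ {v} → ¬ R20 v v
R20-irreflexive {v} = from-yes (all? λ v → ¬? (R20? v v)) v

module R20-at (r : Fin 20) = Discharging R20 R20? R20-symmetric R20-irreflexive r
open R20-at

R20-diameter-two : ∀ r {w} → Far r w → ∃ (CommonNeighbour r w)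
R20-diameter-two r {w} = from-yes (all? λ r → all? λ w → far? r w →-dec any? (commonNeighbour? r w)) r w

R20-poor-unique : ∀ r {u w} → Poor r u → Poor r w → u ≡ w
R20-poor-unique r {u} {w} =
  from-yes (all? λ r → all? λ u → all? λ w → poor? r u →-dec poor? r w →-dec u ≟ w) r u w

R20-helper : ∀ r {u} → Poor r u → ∃ (Helper r u)
R20-helper r {u} = from-yes (all? λ r → all? λ u → poor? r u →-dec any? (helper? r u)) r u

theorem3p8 : Class0 R20
theorem3p8 = class0 R20 λ r → upper-bound r (R20-diameter-two r) (R20-poor-unique r) (R20-helper r)
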